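{- Every monitor in normal form is provably equal, using $\mathcal{E}_v$, to a monitor in reduced normal form.
   Context: Fix a set $Act$ of visible actions and a countably infinite set $Var$ of variables. Monitors $Mon_F$: $m,n ::= v \mid a.m \mid m+n \mid x$ ($a\in Act$, $x\in Var$), verdicts $v ::= \mathit{end}\mid \mathit{yes}\mid \mathit{no}$. A monitor is closed if it contains no variables; $v$-free if it contains no occurrence of verdict $v$. $\sum_{i\in I}m_i$ is $\mathit{end}$ if $I=\emptyset$ and $m_{i_1}+\cdots+m_{i_k}$ otherwise; $m\,[+v]$ means $v$ is an optional summand. Terms are considered up to A1–A4 below. A normal form is a closed term $\sum_{a\in A}a.m_a\,[+\mathit{yes}]\,[+\mathit{no}]$ for some finite $A\subseteq Act$, where each $m_a$ is a normal form different from $\mathit{end}$. A reduced normal form is a normal form $m=\sum_{a\in A}a.m_a\,[+\mathit{yes}]\,[+\mathit{no}]$ such that, if $v\in\{\mathit{yes},\mathit{no}\}$ is a summand of $m$, then each $m_a$ is $v$-free and in reduced normal form. $\mathcal{E}\vdash m=n$: derivability by reflexivity, symmetry, transitivity, substitutivity and congruence for $a.\_$ and $+$. $\mathcal{E}_v$: (A1) $x+y=y+x$; (A2) $x+(y+z)=(x+y)+z$; (A3) $x+x=x$; (A4) $x+\mathit{end}=x$; for each $a\in Act$: $(E_a)$ $a.\mathit{end}=\mathit{end}$; $(Y_a)$ $\mathit{yes}=\mathit{yes}+a.\mathit{yes}$; $(N_a)$ $\mathit{no}=\mathit{no}+a.\mathit{no}$; $(D_a)$ $a.(x+y)=a.x+a.y$.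 -}

module Defs where

open import Data.Nat using (ℕ)
open import Data.Bool using (Bool; true; false)
open import Data.Product using (_×_; _,_; proj₁; proj₂)
open import Data.List using (List; []; _∷_; map)
open import Data.List.Relation.Unary.All using (All)
open import Data.List.Relation.Unary.Unique.Propositional using (Unique)
open import Relation.Binary.PropositionalEquality using (_≡_; _≢_)

data Verdict : Set where
  vend vyes vno : Verdict

module _ (Act : Set) where

  data Mon : Set where
    verd : Verdict → Mon
    _∙_  : Act → Mon → Mon
    _⊕_  : Mon → Mon → Mon
    var  : ℕ → Mon

  infixr 6 _⊕_
  infixr 7 _∙_

  end yes no : Mon
  end = verd vend
  yes = verd vyes
  no  = verd vno

  subst : (ℕ → Mon) → Mon → Mon
  subst σ (verd v) = verd v
  subst σ (a ∙ m)  = a ∙ subst σ m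
  subst σ (m ⊕ n)  = subst σ m ⊕ subst σ n
  subst σ (var x)  = σ x

  data Closed : Mon → Set where
    c-verd : ∀ v → Closed (verd v)
    c-act  : ∀ a {m} → Closed m → Closed (a ∙ m)
    c-plus : ∀ {m n} → Closed m → Closed n → Closed (m ⊕ n)

  data Free (v : Verdict) : Mon → Set where
    f-verd : ∀ {w} → w ≢ v → Free v (verd w)
    f-act  : ∀ a {m} → Free v m → Free v (a ∙ m)
    f-plus : ∀ {m n} → Free v m → Free v n → Free v (m ⊕ n)
    f-var  : ∀ x → Free v (var x)

  x₀ y₀ z₀ : Mon
  x₀ = var 0
  y₀ = var 1
  z₀ = var 2

  data Ev : Mon → Mon → Set where
    A1 : Ev (x₀ ⊕ y₀) (y₀ ⊕ x₀)
    A2 : Ev (x₀ ⊕ (y₀ ⊕ z₀)) ((x₀ ⊕ y₀) ⊕ z₀)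
    A3 : Ev (x₀ ⊕ x₀) x₀
    A4 : Ev (x₀ ⊕ end) x₀
    Ea : ∀ a → Ev (a ∙ end) end
    Ya : ∀ a → Ev yes (yes ⊕ a ∙ yes)
    Na : ∀ a → Ev no (no ⊕ a ∙ no)
    Da : ∀ a → Ev (a ∙ (x₀ ⊕ y₀)) (a ∙ x₀ ⊕ a ∙ y₀)

  infix 4 _⊢_≈_
  data _⊢_≈_ (E : Mon → Mon → Set) : Mon → Mon → Set where
    ax    : ∀ {l r} → E l r → (σ : ℕ → Mon) → E ⊢ subst σ l ≈ subst σ r
    refl  : ∀ {m} → E ⊢ m ≈ m
    sym   : ∀ {m n} → E ⊢ m ≈ n → E ⊢ n ≈ m
    trans : ∀ {m n o} → E ⊢ m ≈ n → E ⊢ n ≈ o → E ⊢ m ≈ o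
    cong∙ : ∀ a {m n} → E ⊢ m ≈ n → E ⊢ a ∙ m ≈ a ∙ n
    cong⊕ : ∀ {m m′ n n′} → E ⊢ m ≈ m′ → E ⊢ n ≈ n′ → E ⊢ m ⊕ n ≈ m′ ⊕ n′

  Sum : List Mon → Mon
  Sum []           = end
  Sum (m ∷ [])     = m
  Sum (m ∷ n ∷ ms) = m ⊕ Sum (n ∷ ms)

  opt : Bool → Mon → Mon → Mon
  opt true  v m = m ⊕ v
  opt false v m = m

  -- Σ_{a∈A} a.m_a [+yes] [+no], with A given as a duplicate-free list of (a , m_a)
  nfTerm : List (Act × Mon) → Bool → Bool → Mon
  nfTerm ps y z = opt z no (opt y yes (Sum (map (λ p → proj₁ p ∙ proj₂ p) ps)))

  data IsNF : Mon → Set where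
    nf : (ps : List (Act × Mon)) → Unique (map proj₁ ps) →
         All (λ p → IsNF (proj₂ p) × proj₂ p ≢ end) ps →
         (y z : Bool) → IsNF (nfTerm ps y z)

  data IsRNF : Mon → Set where
    rnf : (ps : List (Act × Mon)) → Unique (map proj₁ ps) →
          All (λ p → IsNF (proj₂ p) × proj₂ p ≢ end) ps →
          (y z : Bool) →
          (y ≡ true → All (λ p → Free vyes (proj₂ p) × IsRNF (proj₂ p)) ps) →
          (z ≡ true → All (λ p → Free vno (proj₂ p) × IsRNF (proj₂ p)) ps) →
          IsRNF (nfTerm ps y z)

-- Work modulo an ambient sum u of verdicts, writing m ≈[ u ] n for u + m = u + n.
-- The axioms E_a, Y_a and N_a give a.u ≤ u in the join-semilattice order, so by D_a
-- u + a.m = u + a.(u + m), and ≈[ u ] is a congruence for a._ as well as for +.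
-- A normal form is reduced recursively, the ambient of its branches being enlarged by the
-- verdicts of the node: a verdict already in the ambient is dropped, and a branch reducing
-- to end is removed. Then no branch below a verdict v contains v, and at the top the ambient
-- is end, where ≈[ end ] is provable equality.
module Submission where

open import Defs
open import Data.Bool using (Bool; true; false; _∨_; _∧_; not)
open import Data.Empty using (⊥-elim)
open import Data.List using (List; []; _∷_; map)
open import Data.List.Relation.Binary.Subset.Propositional using (_⊆_)
open import Data.List.Relation.Unary.All as All using (All; []; _∷_)
open import Data.List.Relation.Unary.All.Properties using (anti-mono)
open import Data.List.Relation.Unary.AllPairs using ([]; _∷_)
open import Data.List.Relation.Unary.Any using (here; there)
open import Data.List.Relation.Unary.Unique.Propositional using (Unique)
open import Data.Nat using (ℕ; zero; suc)
open import Data.Product using (Σ; _×_; _,_; proj₁; proj₂)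
open import Data.Sum using (_⊎_; inj₁; inj₂; [_,_])
open import Function using (_∘_)
open import Relation.Binary.Bundles using (Setoid)
open import Relation.Binary.PropositionalEquality as P using (_≡_; _≢_)
import Relation.Binary.Reasoning.Setoid as SetoidReasoning

∨-true-⊎ : ∀ x y → x ∨ y ≡ true → x ≡ true ⊎ y ≡ true
∨-true-⊎ true  y e = inj₁ P.refl
∨-true-⊎ false y e = inj₂ e

∨-trueˡ : ∀ x y → x ≡ true → x ∨ y ≡ true
∨-trueˡ true y e = P.refl

∨-trueʳ : ∀ x y → y ≡ true → x ∨ y ≡ true
∨-trueʳ true  y e = P.refl
∨-trueʳ false y e = e

x∧not-y≡true⇒x≡true : ∀ x y → x ∧ not y ≡ true → x ≡ true
x∧not-y≡true⇒x≡true true y e = P.refl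

x∧not-y≡true⇒y≢true : ∀ x y → x ∧ not y ≡ true → y ≢ true
x∧not-y≡true⇒y≢true true true () P.refl

y∨x∧not-y≡y∨x : ∀ x y → y ∨ (x ∧ not y) ≡ y ∨ x
y∨x∧not-y≡y∨x x true  = P.refl
y∨x∧not-y≡y∨x true  false = P.refl
y∨x∧not-y≡y∨x false false = P.refl

module _ (Act : Set) where

  infix 4 _≈_ _≤_ _≈[_]_

  _≈_ : Mon Act → Mon Act → Set
  m ≈ n = _⊢_≈_ Act (Ev Act) m n

  ≈-setoid : Setoid _ _
  ≈-setoid = record
    { Carrier = Mon Act
    ; _≈_ = _≈_
    ; isEquivalence = record { refl = refl ; sym = sym ; trans = trans }
    }

  open SetoidReasoning ≈-setoid

  _≤_ : Mon Act → Mon Act → Set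
  m ≤ n = n ≈ n ⊕ m

  assign : Mon Act → Mon Act → Mon Act → ℕ → Mon Act
  assign m n o zero          = m
  assign m n o (suc zero)    = n
  assign m n o (suc (suc _)) = o

  ⊕-comm : ∀ m n → m ⊕ n ≈ n ⊕ m
  ⊕-comm m n = ax A1 (assign m n m)

  ⊕-assoc : ∀ m n o → m ⊕ (n ⊕ o) ≈ (m ⊕ n) ⊕ o
  ⊕-assoc m n o = ax A2 (assign m n o)

  ⊕-idem : ∀ m → m ⊕ m ≈ m
  ⊕-idem m = ax A3 (assign m m m)

  ⊕-identityʳ : ∀ m → m ⊕ end Act ≈ m
  ⊕-identityʳ m = ax A4 (assign m m m)

  ⊕-identityˡ : ∀ m → end Act ⊕ m ≈ m
  ⊕-identityˡ m = trans (⊕-comm (end Act) m) (⊕-identityʳ m)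

  ∙-end : ∀ a → a ∙ end Act ≈ end Act
  ∙-end a = ax (Ea a) (assign (end Act) (end Act) (end Act))

  ∙yes≤yes : ∀ a → a ∙ yes Act ≤ yes Act
  ∙yes≤yes a = ax (Ya a) (assign (end Act) (end Act) (end Act))

  ∙no≤no : ∀ a → a ∙ no Act ≤ no Act
  ∙no≤no a = ax (Na a) (assign (end Act) (end Act) (end Act))

  ∙-distrib-⊕ : ∀ a m n → a ∙ (m ⊕ n) ≈ a ∙ m ⊕ a ∙ n
  ∙-distrib-⊕ a m n = ax (Da a) (assign m n m)

  ≈⇒≤ : ∀ {m n} → m ≈ n → m ≤ n
  ≈⇒≤ {m} {n} m≈n = trans (sym (⊕-idem n)) (cong⊕ refl (sym m≈n))

  ≤-refl : ∀ {m} → m ≤ m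
  ≤-refl = ≈⇒≤ refl

  ≤-trans : ∀ {m n o} → m ≤ n → n ≤ o → m ≤ o
  ≤-trans {m} {n} {o} m≤n n≤o = begin
    o               ≈⟨ n≤o ⟩
    o ⊕ n           ≈⟨ cong⊕ refl m≤n ⟩
    o ⊕ (n ⊕ m)     ≈⟨ ⊕-assoc o n m ⟩
    (o ⊕ n) ⊕ m     ≈⟨ cong⊕ (sym n≤o) refl ⟩
    o ⊕ m           ∎

  ≤-antisym : ∀ {m n} → m ≤ n → n ≤ m → m ≈ n
  ≤-antisym {m} {n} m≤n n≤m = trans n≤m (trans (⊕-comm m n) (sym m≤n))

  x≤x⊕y : ∀ {m n} → m ≤ m ⊕ n
  x≤x⊕y {m} {n} = begin
    m ⊕ n           ≈⟨ cong⊕ (sym (⊕-idem m)) refl ⟩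
    (m ⊕ m) ⊕ n     ≈⟨ sym (⊕-assoc m m n) ⟩
    m ⊕ (m ⊕ n)     ≈⟨ ⊕-comm m (m ⊕ n) ⟩
    (m ⊕ n) ⊕ m     ∎

  y≤x⊕y : ∀ {m n} → n ≤ m ⊕ n
  y≤x⊕y {m} {n} = ≤-trans x≤x⊕y (≈⇒≤ (⊕-comm n m))

  ⊕-lub : ∀ {m n o} → m ≤ o → n ≤ o → m ⊕ n ≤ o
  ⊕-lub {m} {n} {o} m≤o n≤o = trans n≤o (trans (cong⊕ m≤o refl) (sym (⊕-assoc o m n)))

  ⊕-mono-≤ : ∀ {m m′ n n′} → m ≤ m′ → n ≤ n′ → m ⊕ n ≤ m′ ⊕ n′
  ⊕-mono-≤ m≤m′ n≤n′ = ⊕-lub (≤-trans m≤m′ x≤x⊕y) (≤-trans n≤n′ y≤x⊕y)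

  end≤ : ∀ {m} → end Act ≤ m
  end≤ {m} = sym (⊕-identityʳ m)

  ⊕-distribˡ-⊕ : ∀ u m n → u ⊕ (m ⊕ n) ≈ (u ⊕ m) ⊕ (u ⊕ n)
  ⊕-distribˡ-⊕ u m n = ≤-antisym
    (⊕-lub (≤-trans x≤x⊕y x≤x⊕y) (⊕-mono-≤ y≤x⊕y y≤x⊕y))
    (⊕-lub (⊕-mono-≤ ≤-refl x≤x⊕y) (⊕-mono-≤ ≤-refl y≤x⊕y))

  _≈[_]_ : Mon Act → Mon Act → Mon Act → Set
  m ≈[ u ] n = u ⊕ m ≈ u ⊕ n

  ≈[]-respʳ : ∀ {u m n n′} → m ≈[ u ] n → n ≈ n′ → m ≈[ u ] n′
  ≈[]-respʳ m≈n n≈n′ = trans m≈n (cong⊕ refl n≈n′)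

  ≈[]-⊕ : ∀ {u m m′ n n′} → m ≈[ u ] m′ → n ≈[ u ] n′ → m ⊕ n ≈[ u ] m′ ⊕ n′
  ≈[]-⊕ {u} {m} {m′} {n} {n′} m≈m′ n≈n′ = begin
    u ⊕ (m ⊕ n)             ≈⟨ ⊕-distribˡ-⊕ u m n ⟩
    (u ⊕ m) ⊕ (u ⊕ n)       ≈⟨ cong⊕ m≈m′ n≈n′ ⟩
    (u ⊕ m′) ⊕ (u ⊕ n′)     ≈⟨ sym (⊕-distribˡ-⊕ u m′ n′) ⟩
    u ⊕ (m′ ⊕ n′)           ∎

  ⊕∙≈⊕∙⊕ : ∀ {u} a m → a ∙ u ≤ u → u ⊕ a ∙ m ≈ u ⊕ a ∙ (u ⊕ m)
  ⊕∙≈⊕∙⊕ {u} a m a∙u≤u = begin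
    u ⊕ a ∙ m                 ≈⟨ ≤-antisym (⊕-mono-≤ ≤-refl y≤x⊕y)
                                   (⊕-lub x≤x⊕y (⊕-lub (≤-trans a∙u≤u x≤x⊕y) y≤x⊕y)) ⟩
    u ⊕ (a ∙ u ⊕ a ∙ m)       ≈⟨ cong⊕ refl (sym (∙-distrib-⊕ a u m)) ⟩
    u ⊕ a ∙ (u ⊕ m)           ∎

  ≈[]-∙ : ∀ {u m n} a → a ∙ u ≤ u → m ≈[ u ] n → a ∙ m ≈[ u ] a ∙ n
  ≈[]-∙ {u} {m} {n} a a∙u≤u m≈n = begin
    u ⊕ a ∙ m                 ≈⟨ ⊕∙≈⊕∙⊕ a m a∙u≤u ⟩
    u ⊕ a ∙ (u ⊕ m)           ≈⟨ cong⊕ refl (cong∙ a m≈n) ⟩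
    u ⊕ a ∙ (u ⊕ n)           ≈⟨ sym (⊕∙≈⊕∙⊕ a n a∙u≤u) ⟩
    u ⊕ a ∙ n                 ∎

  ≈[end]⇒≈ : ∀ {m n} → m ≈[ end Act ] n → m ≈ n
  ≈[end]⇒≈ {m} {n} m≈n = trans (sym (⊕-identityˡ m)) (trans m≈n (⊕-identityˡ n))

  Sum-cons : ∀ m ms → Sum Act (m ∷ ms) ≈ m ⊕ Sum Act ms
  Sum-cons m []      = sym (⊕-identityʳ m)
  Sum-cons m (_ ∷ _) = refl

  Sum-cons-≈[] : ∀ {u m n} ms ns → m ≈[ u ] n → Sum Act ms ≈[ u ] Sum Act ns →
                 Sum Act (m ∷ ms) ≈[ u ] n ⊕ Sum Act ns
  Sum-cons-≈[] ms ns m≈n ms≈ns = trans (cong⊕ refl (Sum-cons _ ms)) (≈[]-⊕ m≈n ms≈ns)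

  opt-least : ∀ b v {m w} → m ≤ w → (b ≡ true → v ≤ w) → opt Act b v m ≤ w
  opt-least false v m≤w v≤w = m≤w
  opt-least true  v m≤w v≤w = ⊕-lub m≤w (v≤w P.refl)

  ≤-opt : ∀ b v {m} → m ≤ opt Act b v m
  ≤-opt false v = ≤-refl
  ≤-opt true  v = x≤x⊕y

  opt-summand : ∀ b v {m} → b ≡ true → v ≤ opt Act b v m
  opt-summand true v P.refl = y≤x⊕y

  ∙-opt-≤ : ∀ a b {v m} → a ∙ m ≤ m → a ∙ v ≤ v → a ∙ opt Act b v m ≤ opt Act b v m
  ∙-opt-≤ a false a∙m≤m a∙v≤v = a∙m≤m
  ∙-opt-≤ a true  a∙m≤m a∙v≤v = ≤-trans (≈⇒≤ (∙-distrib-⊕ a _ _)) (⊕-mono-≤ a∙m≤m a∙v≤v)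

  Free-opt : ∀ {v m} b w → Free Act v m → (b ≡ true → w ≢ v) → Free Act v (opt Act b (verd w) m)
  Free-opt false w m-free w≢v = m-free
  Free-opt true  w m-free w≢v = f-plus m-free (f-verd (w≢v P.refl))

  branch : Act × Mon Act → Mon Act
  branch (a , m) = a ∙ m

  S : List (Act × Mon Act) → Mon Act
  S ps = Sum Act (map branch ps)

  nfTerm-least : ∀ ps y z {w} → S ps ≤ w → (y ≡ true → yes Act ≤ w) → (z ≡ true → no Act ≤ w) →
                 nfTerm Act ps y z ≤ w
  nfTerm-least ps y z S≤w yes≤w no≤w = opt-least z (no Act) (opt-least y (yes Act) S≤w yes≤w) no≤w

  S≤nfTerm : ∀ ps y z → S ps ≤ nfTerm Act ps y z
  S≤nfTerm ps y z = ≤-trans (≤-opt y (yes Act)) (≤-opt z (no Act))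

  yes≤nfTerm : ∀ ps y z → y ≡ true → yes Act ≤ nfTerm Act ps y z
  yes≤nfTerm ps y z y≡true = ≤-trans (opt-summand y (yes Act) y≡true) (≤-opt z (no Act))

  no≤nfTerm : ∀ ps y z → z ≡ true → no Act ≤ nfTerm Act ps y z
  no≤nfTerm ps y z = opt-summand z (no Act)

  Free-S : ∀ {v} ps → vend ≢ v → All (Free Act v ∘ proj₂) ps → Free Act v (S ps)
  Free-S []                 end≢v []                    = f-verd end≢v
  Free-S ((a , m) ∷ [])     end≢v (m-free ∷ [])         = f-act a m-free
  Free-S ((a , m) ∷ p ∷ ps) end≢v (m-free ∷ ps-free) = f-plus (f-act a m-free) (Free-S (p ∷ ps) end≢v ps-free)

  Free-nfTerm : ∀ {v} ps y z → vend ≢ v → All (Free Act v ∘ proj₂) ps →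
                (y ≡ true → vyes ≢ v) → (z ≡ true → vno ≢ v) → Free Act v (nfTerm Act ps y z)
  Free-nfTerm ps y z end≢v ps-free yes≢v no≢v =
    Free-opt z vno (Free-opt y vyes (Free-S ps end≢v ps-free) yes≢v) no≢v

  verdicts : Bool → Bool → Mon Act
  verdicts Y Z = nfTerm Act [] Y Z

  ∙-verdicts-≤ : ∀ a Y Z → a ∙ verdicts Y Z ≤ verdicts Y Z
  ∙-verdicts-≤ a Y Z = ∙-opt-≤ a Z (∙-opt-≤ a Y (≈⇒≤ (∙-end a)) (∙yes≤yes a)) (∙no≤no a)

  verdicts-mono : ∀ {Y Y′ Z Z′} → (Y ≡ true → Y′ ≡ true) → (Z ≡ true → Z′ ≡ true) →
                  verdicts Y Z ≤ verdicts Y′ Z′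
  verdicts-mono {Y} {Y′} {Z} {Z′} Y⇒Y′ Z⇒Z′ =
    nfTerm-least [] Y Z end≤ (yes≤nfTerm [] Y′ Z′ ∘ Y⇒Y′) (no≤nfTerm [] Y′ Z′ ∘ Z⇒Z′)

  verdicts-⊕-nfTerm : ∀ Y Z ps y z → verdicts Y Z ⊕ nfTerm Act ps y z ≈ verdicts (Y ∨ y) (Z ∨ z) ⊕ S ps
  verdicts-⊕-nfTerm Y Z ps y z = ≤-antisym lhs≤rhs rhs≤lhs
    where
      lhs rhs : Mon Act
      lhs = verdicts Y Z ⊕ nfTerm Act ps y z
      rhs = verdicts (Y ∨ y) (Z ∨ z) ⊕ S ps

      lhs≤rhs : lhs ≤ rhs
      lhs≤rhs = ⊕-lub (≤-trans (verdicts-mono (∨-trueˡ Y y) (∨-trueˡ Z z)) x≤x⊕y)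
        (nfTerm-least ps y z y≤x⊕y
          (λ y≡true → ≤-trans (yes≤nfTerm [] (Y ∨ y) (Z ∨ z) (∨-trueʳ Y y y≡true)) x≤x⊕y)
          (λ z≡true → ≤-trans (no≤nfTerm [] (Y ∨ y) (Z ∨ z) (∨-trueʳ Z z z≡true)) x≤x⊕y))

      yes≤lhs : Y ∨ y ≡ true → yes Act ≤ lhs
      yes≤lhs = [ (λ Y≡true → ≤-trans (yes≤nfTerm [] Y Z Y≡true) x≤x⊕y)
                , (λ y≡true → ≤-trans (yes≤nfTerm ps y z y≡true) y≤x⊕y) ] ∘ ∨-true-⊎ Y y

      no≤lhs : Z ∨ z ≡ true → no Act ≤ lhs
      no≤lhs = [ (λ Z≡true → ≤-trans (no≤nfTerm [] Y Z Z≡true) x≤x⊕y)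
               , (λ z≡true → ≤-trans (no≤nfTerm ps y z z≡true) y≤x⊕y) ] ∘ ∨-true-⊎ Z z

      rhs≤lhs : rhs ≤ lhs
      rhs≤lhs = ⊕-lub (nfTerm-least [] (Y ∨ y) (Z ∨ z) end≤ yes≤lhs no≤lhs) (≤-trans (S≤nfTerm ps y z) y≤x⊕y)

  IsRNF⇒IsNF : ∀ {m} → IsRNF Act m → IsNF Act m
  IsRNF⇒IsNF (rnf ps ps-unique ps-nf y z _ _) = nf ps ps-unique ps-nf y z

  ≡end⊎≢end : (m : Mon Act) → m ≡ end Act ⊎ m ≢ end Act
  ≡end⊎≢end (verd vend) = inj₁ P.refl
  ≡end⊎≢end (verd vyes) = inj₂ λ ()
  ≡end⊎≢end (verd vno)  = inj₂ λ ()
  ≡end⊎≢end (_ ∙ _)     = inj₂ λ ()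
  ≡end⊎≢end (_ ⊕ _)     = inj₂ λ ()
  ≡end⊎≢end (var _)     = inj₂ λ ()

  FreeOfVerdicts : Bool → Bool → Mon Act → Set
  FreeOfVerdicts Y Z m = (Y ≡ true → Free Act vyes m) × (Z ≡ true → Free Act vno m)

  record Reduct (Y Z : Bool) (m : Mon Act) : Set where
    field
      term    : Mon Act
      isRNF   : IsRNF Act term
      free    : FreeOfVerdicts Y Z term
      ≈-term  : m ≈[ verdicts Y Z ] term

  ReducedBranch : Bool → Bool → Mon Act → Set
  ReducedBranch Y Z m = IsRNF Act m × m ≢ end Act × FreeOfVerdicts Y Z m

  keys : List (Act × Mon Act) → List Act
  keys = map proj₁

  record ReductList (Y Z : Bool) (ps : List (Act × Mon Act)) : Set where
    field
      branches : List (Act × Mon Act)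
      keys-⊆   : keys branches ⊆ keys ps
      unique   : Unique (keys branches)
      reduced  : All (ReducedBranch Y Z ∘ proj₂) branches
      ≈-sum    : S ps ≈[ verdicts Y Z ] S branches

  mutual
    reduce : ∀ Y Z {m} → IsNF Act m → Reduct Y Z m
    reduce Y Z (nf ps ps-unique ps-nf y z) = record
      { term   = nfTerm Act qs y′ z′
      ; isRNF  = rnf qs unique (All.map (λ (q-rnf , q≢end , _) → IsRNF⇒IsNF q-rnf , q≢end) reduced) y′ z′
                   (λ y′≡true → All.zip (yes-free (y′⇒Y∨y y′≡true) , rnf-branches))
                   (λ z′≡true → All.zip (no-free (z′⇒Z∨z z′≡true) , rnf-branches))
      ; free   = (λ Y≡true → Free-nfTerm qs y′ z′ (λ ()) (yes-free (∨-trueˡ Y y Y≡true))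
                    (λ y′≡true → ⊥-elim (x∧not-y≡true⇒y≢true y Y y′≡true Y≡true)) (λ _ ()))
               , (λ Z≡true → Free-nfTerm qs y′ z′ (λ ()) (no-free (∨-trueˡ Z z Z≡true))
                    (λ _ ()) (λ z′≡true → ⊥-elim (x∧not-y≡true⇒y≢true z Z z′≡true Z≡true)))
      ; ≈-term = begin
          verdicts Y Z ⊕ nfTerm Act ps y z         ≈⟨ verdicts-⊕-nfTerm Y Z ps y z ⟩
          verdicts (Y ∨ y) (Z ∨ z) ⊕ S ps          ≈⟨ ≈-sum ⟩
          verdicts (Y ∨ y) (Z ∨ z) ⊕ S qs          ≡⟨ P.cong₂ (λ Y′ Z′ → verdicts Y′ Z′ ⊕ S qs)
                                                        (P.sym (y∨x∧not-y≡y∨x y Y)) (P.sym (y∨x∧not-y≡y∨x z Z)) ⟩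
          verdicts (Y ∨ y′) (Z ∨ z′) ⊕ S qs        ≈⟨ sym (verdicts-⊕-nfTerm Y Z qs y′ z′) ⟩
          verdicts Y Z ⊕ nfTerm Act qs y′ z′       ∎
      }
      where
        y′ z′ : Bool
        y′ = y ∧ not Y
        z′ = z ∧ not Z
        open ReductList (reduce-list (Y ∨ y) (Z ∨ z) ps ps-unique ps-nf) renaming (branches to qs)
        y′⇒Y∨y : y′ ≡ true → Y ∨ y ≡ true
        y′⇒Y∨y = ∨-trueʳ Y y ∘ x∧not-y≡true⇒x≡true y Y
        z′⇒Z∨z : z′ ≡ true → Z ∨ z ≡ true
        z′⇒Z∨z = ∨-trueʳ Z z ∘ x∧not-y≡true⇒x≡true z Z
        rnf-branches : All (IsRNF Act ∘ proj₂) qs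
        rnf-branches = All.map proj₁ reduced
        yes-free : Y ∨ y ≡ true → All (Free Act vyes ∘ proj₂) qs
        yes-free Y∨y≡true = All.map (λ (_ , _ , q-free) → proj₁ q-free Y∨y≡true) reduced
        no-free : Z ∨ z ≡ true → All (Free Act vno ∘ proj₂) qs
        no-free Z∨z≡true = All.map (λ (_ , _ , q-free) → proj₂ q-free Z∨z≡true) reduced

    reduce-list : ∀ Y Z ps → Unique (keys ps) → All (λ p → IsNF Act (proj₂ p) × proj₂ p ≢ end Act) ps →
                  ReductList Y Z ps
    reduce-list Y Z [] [] [] = record
      { branches = [] ; keys-⊆ = λ () ; unique = [] ; reduced = [] ; ≈-sum = refl }
    reduce-list Y Z ((a , m) ∷ ps) (a∉ps ∷ ps-unique) ((m-nf , _) ∷ ps-nf)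
      with reduce Y Z m-nf | reduce-list Y Z ps ps-unique ps-nf
    ... | r | rs with ≡end⊎≢end (Reduct.term r)
    ...   | inj₁ r≡end = record
      { branches = branches
      ; keys-⊆   = there ∘ keys-⊆
      ; unique   = unique
      ; reduced  = reduced
      ; ≈-sum    = ≈[]-respʳ (Sum-cons-≈[] (map branch ps) (map branch branches) a∙m≈end ≈-sum) (⊕-identityˡ _)
      }
      where
        open ReductList rs
        a∙m≈end : a ∙ m ≈[ verdicts Y Z ] end Act
        a∙m≈end = ≈[]-respʳ (≈[]-∙ a (∙-verdicts-≤ a Y Z) (Reduct.≈-term r))
                    (P.subst (λ t → a ∙ t ≈ end Act) (P.sym r≡end) (∙-end a))
    ...   | inj₂ r≢end = record
      { branches = (a , term) ∷ branches
      ; keys-⊆   = λ { (here e) → here e ; (there k) → there (keys-⊆ k) }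
      ; unique   = anti-mono keys-⊆ a∉ps ∷ unique
      ; reduced  = (isRNF , r≢end , free) ∷ reduced
      ; ≈-sum    = ≈[]-respʳ (Sum-cons-≈[] (map branch ps) (map branch branches)
                               (≈[]-∙ a (∙-verdicts-≤ a Y Z) ≈-term) ≈-sum)
                             (sym (Sum-cons (a ∙ term) (map branch branches)))
      }
      where
        open Reduct r
        open ReductList rs

lemma7 : (Act : Set) (m : Mon Act) → IsNF Act m →
    Σ (Mon Act) (λ n → IsRNF Act n × _⊢_≈_ Act (Ev Act) m n)
lemma7 Act m m-nf = term , isRNF , ≈[end]⇒≈ Act ≈-term
  where open Reduct (reduce Act false false m-nf)
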